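{- Let $\mathcal{N}=(Q,Act,\delta)$ be a one-counter net, $p,q\in Q$ and $m,n,m',n'\in\mathbb{N}$ with $p(m)\preceq q(n)$ and $p(m')\not\preceq q(n')$, and assume that either ($m>0$ and $n'>0$), or ($m>0$ and $n=n'=0$), or ($m=m'=0$ and $n'>0$). Then there are $p',q'\in Q$ and $i,j\in\{ -1,0,1\}$ such that $p'(m+i)\preceq q'(n+j)$, $p'(m'+i)\not\preceq q'(n'+j)$, and $\mathrm{rank}(p'(m'+i),q'(n'+j))<\mathrm{rank}(p(m'),q(n'))$.
   Context: A one-counter net is $\mathcal{N}=(Q,Act,\delta)$ with finite $Q$, $Act$ and rules $\delta\subseteq Q\times Act\times\{ -1,0,1\}\times Q$; its LTS has states $q(m)\in Q\times\mathbb{N}$ (all counter values nonnegative) with $q(m)\xrightarrow{a}q'(n)$ iff $(q,a,n-m,q')\in\delta$. $\preceq$ is simulation preorder on this LTS. Stratified simulation: $\preceq_0$ relates all pairs of states; $s\preceq_{k+1}s'$ iff for each $s\xrightarrow{a}t$ there is $s'\xrightarrow{a}t'$ with $t\preceq_k t'$. For this (image-finite) LTS, $\preceq=\bigcap_{k\in\mathbb{N}}\preceq_k$, and for $s\not\preceq s'$, $\mathrm{rank}(s,s')$ is the least $k\in\mathbb{N}$ with $s\not\preceq_k s'$. -}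

module Defs where

open import Data.Nat using (ℕ; zero; suc; _<_; _>_)
open import Data.Fin using (Fin)
open import Data.List using (List)
open import Data.List.Membership.Propositional using (_∈_)
open import Data.Product using (_×_; _,_; ∃; Σ)
open import Relation.Nullary using (¬_)
open import Data.Unit using (⊤)

data Eff : Set where
  dec stay inc : Eff

data Shift : Eff → ℕ → ℕ → Set where
  shift-dec  : ∀ {k} → Shift dec (suc k) k
  shift-stay : ∀ {k} → Shift stay k k
  shift-inc  : ∀ {k} → Shift inc k (suc k)

record OCN : Set where
  field
    nQ : ℕ
    nA : ℕ
    δ  : List (Fin nQ × Fin nA × Eff × Fin nQ)

module _ (N : OCN) where
  open OCN N

  Q : Set
  Q = Fin nQ

  Act : Set
  Act = Fin nA

  State : Set
  State = Q × ℕ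

  Step : State → Act → State → Set
  Step (q , m) a (q' , n) = ∃ λ e → ((q , a , e , q') ∈ δ) × Shift e m n

  IsSimulation : (State → State → Set) → Set
  IsSimulation R = ∀ s s' → R s s' → ∀ a t → Step s a t →
                   ∃ λ t' → Step s' a t' × R t t'

  _≼_ : State → State → Set₁
  s ≼ s' = Σ (State → State → Set) λ R → IsSimulation R × R s s'

  Sim : ℕ → State → State → Set
  Sim zero    s s' = ⊤
  Sim (suc k) s s' = ∀ a t → Step s a t → ∃ λ t' → Step s' a t' × Sim k t t'

  IsRank : State → State → ℕ → Set
  IsRank s s' k = ¬ Sim k s s' × (∀ j → j < k → Sim j s s')

-- Let k + 1 be the rank of p(m') against q(n'). Some move p(m') -a-> p₁(m₁') of the
-- attacker cannot be answered from q(n') within ≼ₖ. The side conditions ensure the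
-- same rule fires from p(m); the simulation p(m) ≼ q(n) answers it by a rule from q(n),
-- which in turn fires from q(n'). The resulting pair p₁(m₁') , q₁(n₁') fails ≼ₖ, so
-- its rank is at most k, while p₁(m₁) ≼ q₁(n₁). Ranks exist because ≼ₖ is decidable,
-- the LTS of a one-counter net being finitely branching.
module Submission where

open import Defs
open import Data.Nat using (ℕ; zero; suc; _<_; _>_; _≤_; z≤n; s≤s)
open import Data.Nat.Properties using (≤-refl; <⇒≤; m<1+n⇒m<n∨m≡n)
open import Data.Fin using (_≟_)
open import Data.Product using (_×_; _,_; Σ; ∃; ∃₂)
open import Data.Sum using (_⊎_; inj₁; inj₂)
open import Data.Empty using (⊥-elim)
open import Data.Unit using (tt)
open import Data.List using (List; []; [_]; map; concatMap)
open import Data.List.Membership.Propositional using (_∈_; find; lose)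
open import Data.List.Membership.Propositional.Properties using (∈-map⁺; ∈-map⁻; ∈-concatMap⁺; ∈-concatMap⁻)
open import Data.List.Relation.Unary.Any using (Any; here; any?)
open import Data.List.Relation.Unary.All as All using (all?)
open import Data.List.Relation.Unary.All.Properties using (¬All⇒Any¬)
open import Relation.Nullary using (¬_; Dec; yes; no; contradiction)
open import Relation.Nullary.Decidable using (map′; _×-dec_)
open import Relation.Unary using (Decidable)
open import Relation.Binary.PropositionalEquality using (_≡_; refl)
open import Function using (_∘_)

module LeastFailure {P : ℕ → Set} (P? : Decidable P) where

  IsLeastFailure : ℕ → Set
  IsLeastFailure r = ¬ P r × (∀ j → j < r → P j)

  allBelow⊎leastFailureBelow : ∀ k → (∀ j → j < k → P j) ⊎ (∃ λ r → r < k × IsLeastFailure r)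
  allBelow⊎leastFailureBelow zero = inj₁ λ j ()
  allBelow⊎leastFailureBelow (suc k) with allBelow⊎leastFailureBelow k
  ... | inj₂ (r , r<k , least) = inj₂ (r , s≤s (<⇒≤ r<k) , least)
  ... | inj₁ below with P? k
  ...   | no ¬Pk = inj₂ (k , ≤-refl , ¬Pk , below)
  ...   | yes Pk = inj₁ λ j j<1+k → belowOrAt (m<1+n⇒m<n∨m≡n j<1+k)
    where
    belowOrAt : ∀ {j} → j < k ⊎ j ≡ k → P j
    belowOrAt (inj₁ j<k)  = below _ j<k
    belowOrAt (inj₂ refl) = Pk

  leastFailure : ∀ {k} → ¬ P k → ∃ λ r → r ≤ k × IsLeastFailure r
  leastFailure {k} ¬Pk with allBelow⊎leastFailureBelow (suc k)
  ... | inj₁ below                  = contradiction (below k ≤-refl) ¬Pk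
  ... | inj₂ (r , s≤s r≤k , least) = r , r≤k , least

shifts : Eff → ℕ → List ℕ
shifts dec  zero    = []
shifts dec  (suc m) = [ m ]
shifts stay m       = [ m ]
shifts inc  m       = [ suc m ]

Shift⇒∈shifts : ∀ {e m n} → Shift e m n → n ∈ shifts e m
Shift⇒∈shifts shift-dec  = here refl
Shift⇒∈shifts shift-stay = here refl
Shift⇒∈shifts shift-inc  = here refl

∈shifts⇒Shift : ∀ e m {n} → n ∈ shifts e m → Shift e m n
∈shifts⇒Shift dec  (suc m) (here refl) = shift-dec
∈shifts⇒Shift stay m       (here refl) = shift-stay
∈shifts⇒Shift inc  m       (here refl) = shift-inc

Shift-enabled : ∀ {e m m' m₁'} → (m' > 0 → m > 0) → Shift e m' m₁' → ∃ (Shift e m)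
Shift-enabled {m = zero}  m'>0⇒m>0 shift-dec with m'>0⇒m>0 (s≤s z≤n)
... | ()
Shift-enabled {m = suc m} _        shift-dec  = m , shift-dec
Shift-enabled             _        shift-stay = _ , shift-stay
Shift-enabled             _        shift-inc  = _ , shift-inc

module OCNProperties (N : OCN) where
  open OCN N

  Rule : Set
  Rule = Q N × Act N × Eff × Q N

  fire : State N → Rule → List (Act N × State N)
  fire (q , m) (q₀ , a , e , q₁) with q₀ ≟ q
  ... | yes _ = map (λ n → a , q₁ , n) (shifts e m)
  ... | no _  = []

  successors : State N → List (Act N × State N)
  successors s = concatMap (fire s) δ

  Step⇒∈successors : ∀ {s a t} → Step N s a t → (a , t) ∈ successors s
  Step⇒∈successors {q , m} {a} {q₁ , n} (e , ρ∈δ , sh) = ∈-concatMap⁺ (fire (q , m)) (lose ρ∈δ fires)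
    where
    fires : (a , q₁ , n) ∈ fire (q , m) (q , a , e , q₁)
    fires with q ≟ q
    ... | yes _  = ∈-map⁺ _ (Shift⇒∈shifts sh)
    ... | no q≢q = contradiction refl q≢q

  ∈successors⇒Step : ∀ {s a t} → (a , t) ∈ successors s → Step N s a t
  ∈successors⇒Step {s} t∈ with find (∈-concatMap⁻ (fire s) {xs = δ} t∈)
  ... | ρ , ρ∈δ , t∈fire = fired s ρ ρ∈δ t∈fire
    where
    fired : ∀ s ρ {a t} → ρ ∈ δ → (a , t) ∈ fire s ρ → Step N s a t
    fired (q , m) (q₀ , a , e , q₁) ρ∈δ t∈fire with q₀ ≟ q
    fired (q , m) (q₀ , a , e , q₁) ρ∈δ t∈fire | yes refl with ∈-map⁻ _ t∈fire
    ... | n , n∈shifts , refl = e , ρ∈δ , ∈shifts⇒Shift e m n∈shifts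
    fired (q , m) (q₀ , a , e , q₁) ρ∈δ ()      | no _

  CanMatch : ℕ → State N → Act N → State N → Set
  CanMatch k s' a t = ∃ λ t' → Step N s' a t' × Sim N k t t'

  Sim-suc⇒All-CanMatch : ∀ {k s s'} → Sim N (suc k) s s' →
                         All.All (λ (a , t) → CanMatch k s' a t) (successors s)
  Sim-suc⇒All-CanMatch sim = All.tabulate λ t∈ → sim _ _ (∈successors⇒Step t∈)

  All-CanMatch⇒Sim-suc : ∀ {k s s'} → All.All (λ (a , t) → CanMatch k s' a t) (successors s) →
                         Sim N (suc k) s s'
  All-CanMatch⇒Sim-suc all a t step = All.lookup all (Step⇒∈successors step)

  sim? : ∀ k s s' → Dec (Sim N k s s')
  canMatch? : ∀ k s' a t → Dec (CanMatch k s' a t)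

  sim? zero    s s' = yes tt
  sim? (suc k) s s' = map′ All-CanMatch⇒Sim-suc Sim-suc⇒All-CanMatch
                           (all? (λ (a , t) → canMatch? k s' a t) (successors s))

  canMatch? k s' a t = map′ matched unmatched
                            (any? (λ (b , t') → (b ≟ a) ×-dec sim? k t t') (successors s'))
    where
    matched : Any (λ (b , t') → b ≡ a × Sim N k t t') (successors s') → CanMatch k s' a t
    matched any with find any
    ... | (_ , t') , t'∈ , refl , sim = t' , ∈successors⇒Step t'∈ , sim

    unmatched : CanMatch k s' a t → Any (λ (b , t') → b ≡ a × Sim N k t t') (successors s')
    unmatched (t' , step , sim) = lose (Step⇒∈successors step) (refl , sim)

  unmatchedMove : ∀ {k s s'} → ¬ Sim N (suc k) s s' →
                  ∃₂ λ a t → Step N s a t × ¬ CanMatch k s' a t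
  unmatchedMove {k} {s} {s'} ¬sim
    with find (¬All⇒Any¬ (λ (a , t) → canMatch? k s' a t) (successors s) (¬sim ∘ All-CanMatch⇒Sim-suc))
  ... | (a , t) , t∈ , ¬match = a , t , ∈successors⇒Step t∈ , ¬match

  ≼⇒Sim : ∀ k {s s'} → _≼_ N s s' → Sim N k s s'
  ≼⇒Sim zero    _              = tt
  ≼⇒Sim (suc k) (R , isSim , sRs') a t step with isSim _ _ sRs' a t step
  ... | t' , step' , tRt' = t' , step' , ≼⇒Sim k (R , isSim , tRt')

  rankAtMost : ∀ {k s s'} → ¬ Sim N k s s' → ∃ λ r → r ≤ k × IsRank N s s' r
  rankAtMost = LeastFailure.leastFailure (λ j → sim? j _ _)

attackerEnabled : ∀ {m n m' n' : ℕ} →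
  (m > 0 × n' > 0) ⊎ (m > 0 × n ≡ 0 × n' ≡ 0) ⊎ (m ≡ 0 × m' ≡ 0 × n' > 0) → m' > 0 → m > 0
attackerEnabled (inj₁ (m>0 , _))             _  = m>0
attackerEnabled (inj₂ (inj₁ (m>0 , _)))      _  = m>0
attackerEnabled (inj₂ (inj₂ (_ , refl , _))) ()

defenderEnabled : ∀ {m n m' n' : ℕ} →
  (m > 0 × n' > 0) ⊎ (m > 0 × n ≡ 0 × n' ≡ 0) ⊎ (m ≡ 0 × m' ≡ 0 × n' > 0) → n > 0 → n' > 0
defenderEnabled (inj₁ (_ , n'>0))            _  = n'>0
defenderEnabled (inj₂ (inj₁ (_ , refl , _))) ()
defenderEnabled (inj₂ (inj₂ (_ , _ , n'>0))) _  = n'>0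

lemma4 : (N : OCN) (p q : Q N) (m n m' n' : ℕ) →
    _≼_ N (p , m) (q , n) →
    ¬ _≼_ N (p , m') (q , n') →
    ((m > 0 × n' > 0) ⊎ (m > 0 × n ≡ 0 × n' ≡ 0) ⊎ (m ≡ 0 × m' ≡ 0 × n' > 0)) →
    (r : ℕ) → IsRank N (p , m') (q , n') r →
    Σ (Q N) λ p₁ → Σ (Q N) λ q₁ → Σ Eff λ i → Σ Eff λ j →
    Σ ℕ λ m₁ → Σ ℕ λ n₁ → Σ ℕ λ m₁' → Σ ℕ λ n₁' →
    Shift i m m₁ × Shift j n n₁ × Shift i m' m₁' × Shift j n' n₁' ×
    _≼_ N (p₁ , m₁) (q₁ , n₁) ×
    ¬ _≼_ N (p₁ , m₁') (q₁ , n₁') ×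
    (∃ λ r₁ → IsRank N (p₁ , m₁') (q₁ , n₁') r₁ × r₁ < r)
lemma4 N p q m n m' n' _ _ _ zero (¬sim₀ , _) = ⊥-elim (¬sim₀ tt)
lemma4 N p q m n m' n' (R , isSim , pRq) _ sides (suc k) (¬sim , _) =
  let a , (p₁ , m₁') , (i , ρ∈δ , shift-m') , unmatched = unmatchedMove ¬sim
      m₁ , shift-m = Shift-enabled (attackerEnabled sides) shift-m'
      (q₁ , n₁) , (j , σ∈δ , shift-n) , p₁Rq₁ = isSim _ _ pRq a (p₁ , m₁) (i , ρ∈δ , shift-m)
      n₁' , shift-n' = Shift-enabled (defenderEnabled sides) shift-n
      ¬sim₁ : ¬ Sim N k (p₁ , m₁') (q₁ , n₁')
      ¬sim₁ sim₁ = unmatched ((q₁ , n₁') , (j , σ∈δ , shift-n') , sim₁)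
      r₁ , r₁≤k , rank₁ = rankAtMost ¬sim₁
  in p₁ , q₁ , i , j , m₁ , n₁ , m₁' , n₁' , shift-m , shift-n , shift-m' , shift-n' ,
     (R , isSim , p₁Rq₁) , (λ p₁≼q₁ → ¬sim₁ (≼⇒Sim k p₁≼q₁)) , r₁ , rank₁ , s≤s r₁≤k
  where open OCNProperties N
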